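{- Let $d=1$. Suppose there are $m$ boxes, each of width $1$ and height at most $\varepsilon$, each containing a packing of non-big non-dense items, and the total weight $v_1$ of the items in each box is at most $1/2$. Then the items of these boxes can be packed into at most $2+m\left(\tfrac12+\tfrac{\varepsilon}{1-\varepsilon}\right)$ bins such that each resulting bin is $\varepsilon$-slacked.
   Context: Items are $(2,1)$ items: rectangles of width $w(i)$, height $h(i)$ in $[0,1]$ with one nonnegative weight $v_1(i)\le 1$; a bin is $[0,1]^2$ with weight capacity $1$. Standing parameters: $\varepsilon^{ -1}\in 2\mathbb Z$, $\varepsilon\le 1/8$; $\varepsilon_1^{ -1},\varepsilon_2^{ -1}\in\mathbb Z$, $\varepsilon_1\le\min(1/5,2\varepsilon/3)$, $\varepsilon_2\le\varepsilon\varepsilon_1^2/2$; all items are $(\varepsilon_2,\varepsilon_1)$-non-medium (none of $w(i),h(i),v_1(i)$ lies in $(\varepsilon_2,\varepsilon_1]$). An item is big if $w(i)>\varepsilon_1$ and $h(i)>\varepsilon_1$. An item is dense if $w(i)h(i)=0$ or $v_1(i)/(w(i)h(i))>1/\varepsilon_1^2$; otherwise non-dense. A bin with item set $J$ is $\mu$-slacked if $v_1(J)\le 1-\mu$, or $|J|=1$, or ($|J|=2$, all items of $J$ dense, and $v_1(i)\le 1/2$ for each $i\in J$).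
   Formalization: The item widths, heights and weights, the box heights and the item positions in the boxes are rational, and the item positions in the resulting bins are taken in ℚ. -}

module Defs where

open import Data.Nat using (ℕ)
open import Data.Integer using (+_)
open import Data.Rational using (ℚ; 0ℚ; 1ℚ; ½; _+_; _*_; _-_; _÷_; _≤_; _<_; _/_; ≢-nonZero)
open import Data.Rational.Properties using (_≟_)
open import Data.Product using (_×_; Σ)
open import Data.Sum using (_⊎_)
open import Data.List using (List; foldr; length; map)
open import Data.List.Relation.Unary.All using (All)
open import Data.List.Relation.Unary.AllPairs using (AllPairs)
open import Relation.Nullary using (¬_; yes; no)
open import Relation.Binary.PropositionalEquality using (_≡_)

toℚ : ℕ → ℚ
toℚ n = + n / 1

-- total division (p / 0 := 0); only used where the denominator is nonzero
_÷₀_ : ℚ → ℚ → ℚ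
p ÷₀ q with q ≟ 0ℚ
... | yes _ = 0ℚ
... | no q≢0 = _÷_ p q {{≢-nonZero q≢0}}

-- a (2,1) item (d = 1): width, height, one weight
record Item : Set where
  constructor item
  field
    w : ℚ
    h : ℚ
    v : ℚ
open Item public

ValidItem : Item → Set
ValidItem i = (0ℚ ≤ w i × w i ≤ 1ℚ) × (0ℚ ≤ h i × h i ≤ 1ℚ) × (0ℚ ≤ v i × v i ≤ 1ℚ)

InOC : ℚ → ℚ → ℚ → Set
InOC a b x = a < x × x ≤ b

NonMedium : ℚ → ℚ → Item → Set
NonMedium ε₂ ε₁ i = ¬ InOC ε₂ ε₁ (w i) × ¬ InOC ε₂ ε₁ (h i) × ¬ InOC ε₂ ε₁ (v i)

Big : ℚ → Item → Set
Big ε₁ i = ε₁ < w i × ε₁ < h i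

Dense : ℚ → Item → Set
Dense ε₁ i = (w i * h i ≡ 0ℚ) ⊎ (1ℚ ÷₀ (ε₁ * ε₁) < v i ÷₀ (w i * h i))

-- an item placed with its lower-left corner at (x , y) (no rotation)
record Placed : Set where
  constructor place
  field
    itm : Item
    x : ℚ
    y : ℚ
open Placed public

InRegion : ℚ → ℚ → Placed → Set
InRegion W H p =
  (0ℚ ≤ x p × x p + w (itm p) ≤ W) × (0ℚ ≤ y p × y p + h (itm p) ≤ H)

-- the open interiors of two placed items intersect
Overlap : Placed → Placed → Set
Overlap p q =
  (x p < x p + w (itm p)) × (x q < x q + w (itm q)) ×
  (x p < x q + w (itm q)) × (x q < x p + w (itm p)) ×
  (y p < y p + h (itm p)) × (y q < y q + h (itm q)) ×
  (y p < y q + h (itm q)) × (y q < y p + h (itm p))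

IsPacking : ℚ → ℚ → List Placed → Set
IsPacking W H ps = All (InRegion W H) ps × AllPairs (λ p q → ¬ Overlap p q) ps

weight : List Item → ℚ
weight = foldr (λ i s → v i + s) 0ℚ

items : List Placed → List Item
items = map itm

IsBin : List Placed → Set
IsBin ps = IsPacking 1ℚ 1ℚ ps × weight (items ps) ≤ 1ℚ

Slacked : ℚ → ℚ → List Item → Set
Slacked ε₁ μ J =
  weight J ≤ 1ℚ - μ
  ⊎ length J ≡ 1
  ⊎ (length J ≡ 2 × All (Dense ε₁) J × All (λ i → v i ≤ ½) J)

-- Every item weighs at most ε/2: being non-big and non-medium it has a side of length at most ε₂, so its
-- area is at most ε₂ ≤ εε₁²/2, and being non-dense it weighs at most area/ε₁². Cut each box after the
-- longest prefix of weight at most (1-ε)/2; if anything is left over, the prefix weighs more than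
-- (1-ε)/2 - ε/2, so the remainder weighs at most ε. With ε = 1/K, stacking the prefixes two at a time and
-- the remainders K-1 at a time gives ε-slacked bins (height at most 1, weight at most 1-ε), and
-- (⌊m/2⌋ + 1) + (⌊m/(K-1)⌋ + 1) ≤ 2 + m(1/2 + ε/(1-ε)) bins suffice.
module Submission where

open import Defs
open import Data.Nat using (ℕ; zero; suc)
import Data.Nat as ℕ
import Data.Nat.Properties as ℕ
open import Data.Nat.DivMod using (_%_; m/n*n≤m; m≡m%n+[m/n]*n; m%n<n) renaming (_/_ to _/ℕ_)
open import Data.Fin using (Fin)
open import Data.Integer as ℤ using (+_)
open import Data.Integer.Tactic.RingSolver using (solve-∀)
open import Data.Rational
  using (ℚ; 0ℚ; 1ℚ; ½; _+_; _*_; _-_; -_; _/_; 1/_; _≤_; _<_; mkℚ; toℚᵘ; NonZero; ≢-nonZero; positive; nonNegative)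
open import Data.Rational.Properties
import Data.Rational.Unnormalised as ℚᵘ
import Data.Rational.Unnormalised.Properties as ℚᵘ
open import Data.Rational.Solver using (module +-*-Solver)
open +-*-Solver
import Data.Nat.Coprimality as Coprimality
open import Data.Product using (_×_; _,_; proj₁; proj₂; Σ; ∃)
import Data.Product as Product
open import Data.Sum using (_⊎_; inj₁; inj₂)
open import Data.List using (List; []; _∷_; _++_; concat; tabulate; length; map; take; drop)
import Data.List.Properties as List
open import Data.List.Relation.Unary.All as All using (All; []; _∷_)
import Data.List.Relation.Unary.All.Properties as All
open import Data.List.Relation.Unary.AllPairs as AllPairs using (AllPairs; []; _∷_)
import Data.List.Relation.Unary.AllPairs.Properties as AllPairs
open import Data.List.Relation.Binary.Permutation.Propositional
  using (_↭_; ↭-refl; ↭-trans; ↭-reflexive; module PermutationReasoning)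
import Data.List.Relation.Binary.Permutation.Propositional.Properties as ↭
open import Relation.Nullary using (¬_; yes; no; contradiction)
open import Relation.Binary.PropositionalEquality
open import Function using (_∘_)
open import Relation.Nullary.Decidable using (toWitness)

p≤p+q : ∀ {p q} → 0ℚ ≤ q → p ≤ p + q
p≤p+q {p} {q} 0≤q = subst (_≤ p + q) (+-identityʳ p) (+-monoʳ-≤ p 0≤q)

p≤q⇒0≤q-p : ∀ {p q} → p ≤ q → 0ℚ ≤ q - p
p≤q⇒0≤q-p {p} {q} p≤q = subst (_≤ q - p) (+-inverseʳ p) (+-monoˡ-≤ (- p) p≤q)

p-q≤p : ∀ p {q} → 0ℚ ≤ q → p - q ≤ p
p-q≤p p 0≤q = subst (p - _ ≤_) (+-identityʳ p) (+-monoʳ-≤ p (neg-antimono-≤ 0≤q))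

*-nonNeg : ∀ {p q} → 0ℚ ≤ p → 0ℚ ≤ q → 0ℚ ≤ p * q
*-nonNeg {p} {q} 0≤p 0≤q =
  nonNegative⁻¹ (p * q) {{nonNeg*nonNeg⇒nonNeg p {{nonNegative 0≤p}} q {{nonNegative 0≤q}}}}

*≡1⇒pos : ∀ {p q} → 0ℚ ≤ q → p * q ≡ 1ℚ → 0ℚ < p
*≡1⇒pos {p} {q} 0≤q pq≡1 with p ≤? 0ℚ
... | no p≰0 = ≰⇒> p≰0
... | yes p≤0 = contradiction
  (subst₂ _≤_ pq≡1 (*-zeroˡ q) (*-monoʳ-≤-nonNeg q {{nonNegative 0≤q}} p≤0))
  (λ 1≤0 → <-irrefl refl (<-≤-trans (positive⁻¹ 1ℚ) 1≤0))

÷₀-*-cancel : ∀ p {q} → q ≢ 0ℚ → (p ÷₀ q) * q ≡ p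
÷₀-*-cancel p {q} q≢0 with q ≟ 0ℚ
... | yes q≡0 = contradiction q≡0 q≢0
... | no q≢0′ = begin
  p * 1/ q * q             ≡⟨ *-assoc p (1/ q) q ⟩
  p * (1/ q * q)           ≡⟨ cong (p *_) (*-inverseˡ q) ⟩
  p * 1ℚ                   ≡⟨ *-identityʳ p ⟩
  p                        ∎
  where
  open ≡-Reasoning
  instance
    q-nonZero : NonZero q
    q-nonZero = ≢-nonZero q≢0′

⅛<1 : + 1 / 8 < 1ℚ
⅛<1 = toWitness {a? = + 1 / 8 <? 1ℚ} _

-- toℚ normalises, so compare in ℚᵘ, where the claim is a ring identity on numerators and denominators.
toℚ-suc : ∀ n → toℚ (suc n) ≡ 1ℚ + toℚ n
toℚ-suc n = toℚᵘ-injective (ℚᵘ.≃-trans unnormalised (ℚᵘ.≃-sym (toℚᵘ-homo-+ 1ℚ (toℚ n))))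
  where
  toℚ≡mkℚ : ∀ k → toℚ k ≡ mkℚ (+ k) 0 (Coprimality.sym (Coprimality.1-coprimeTo k))
  toℚ≡mkℚ k = ↥p/↧p≡p (mkℚ (+ k) 0 (Coprimality.sym (Coprimality.1-coprimeTo k)))
  identity : ∀ (z : ℤ.ℤ) → (+ 1 ℤ.+ z) ℤ.* (+ 1 ℤ.* + 1) ≡ (+ 1 ℤ.* + 1 ℤ.+ z ℤ.* + 1) ℤ.* + 1
  identity = solve-∀
  unnormalised : toℚᵘ (toℚ (suc n)) ℚᵘ.≃ (toℚᵘ 1ℚ ℚᵘ.+ toℚᵘ (toℚ n))
  unnormalised rewrite toℚ≡mkℚ (suc n) | toℚ≡mkℚ n = ℚᵘ.*≡* (identity (+ n))

toℚ-+ : ∀ a b → toℚ (a ℕ.+ b) ≡ toℚ a + toℚ b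
toℚ-+ zero b = sym (+-identityˡ (toℚ b))
toℚ-+ (suc a) b = begin
  toℚ (suc (a ℕ.+ b))      ≡⟨ toℚ-suc (a ℕ.+ b) ⟩
  1ℚ + toℚ (a ℕ.+ b)       ≡⟨ cong (_+_ 1ℚ) (toℚ-+ a b) ⟩
  1ℚ + (toℚ a + toℚ b)     ≡⟨ +-assoc 1ℚ (toℚ a) (toℚ b) ⟨
  (1ℚ + toℚ a) + toℚ b     ≡⟨ cong (_+ toℚ b) (toℚ-suc a) ⟨
  toℚ (suc a) + toℚ b      ∎
  where open ≡-Reasoning

toℚ-suc-* : ∀ n p → toℚ (suc n) * p ≡ p + toℚ n * p
toℚ-suc-* n p = begin
  toℚ (suc n) * p          ≡⟨ cong (_* p) (toℚ-suc n) ⟩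
  (1ℚ + toℚ n) * p         ≡⟨ solve 2 (λ t q → (con 1ℚ :+ t) :* q := q :+ t :* q) refl (toℚ n) p ⟩
  p + toℚ n * p            ∎
  where open ≡-Reasoning

toℚ-* : ∀ a b → toℚ (a ℕ.* b) ≡ toℚ a * toℚ b
toℚ-* zero b = sym (*-zeroˡ (toℚ b))
toℚ-* (suc a) b = begin
  toℚ (b ℕ.+ a ℕ.* b)      ≡⟨ toℚ-+ b (a ℕ.* b) ⟩
  toℚ b + toℚ (a ℕ.* b)    ≡⟨ cong (_+_ (toℚ b)) (toℚ-* a b) ⟩
  toℚ b + toℚ a * toℚ b    ≡⟨ toℚ-suc-* a (toℚ b) ⟨
  toℚ (suc a) * toℚ b      ∎
  where open ≡-Reasoning

toℚ-nonNeg : ∀ n → 0ℚ ≤ toℚ n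
toℚ-nonNeg n = nonNegative⁻¹ (toℚ n) {{normalize-nonNeg n 1}}

toℚ-mono-≤ : ∀ {a b} → a ℕ.≤ b → toℚ a ≤ toℚ b
toℚ-mono-≤ {a} {b} a≤b = begin
  toℚ a                    ≤⟨ p≤p+q (toℚ-nonNeg (b ℕ.∸ a)) ⟩
  toℚ a + toℚ (b ℕ.∸ a)    ≡⟨ toℚ-+ a (b ℕ.∸ a) ⟨
  toℚ (a ℕ.+ (b ℕ.∸ a))    ≡⟨ cong toℚ (ℕ.m+[n∸m]≡n a≤b) ⟩
  toℚ b                    ∎
  where open ≤-Reasoning

m≤[1+m/n]*n : ∀ m n .{{_ : ℕ.NonZero n}} → m ℕ.≤ suc (m /ℕ n) ℕ.* n
m≤[1+m/n]*n m n = begin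
  m                        ≡⟨ m≡m%n+[m/n]*n m n ⟩
  m % n ℕ.+ m /ℕ n ℕ.* n   ≤⟨ ℕ.+-monoˡ-≤ (m /ℕ n ℕ.* n) (ℕ.<⇒≤ (m%n<n m n)) ⟩
  n ℕ.+ m /ℕ n ℕ.* n       ∎
  where open ℕ.≤-Reasoning

toℚ[1+m/n]≤1+m*x : ∀ m n .{{_ : ℕ.NonZero n}} {x} → x * toℚ n ≡ 1ℚ → toℚ (suc (m /ℕ n)) ≤ 1ℚ + toℚ m * x
toℚ[1+m/n]≤1+m*x m n {x} x*n≡1 = begin
  toℚ (suc (m /ℕ n))              ≡⟨ toℚ-suc (m /ℕ n) ⟩
  1ℚ + toℚ (m /ℕ n)               ≡⟨ cong (_+_ 1ℚ) (begin-equality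
      toℚ (m /ℕ n)                ≡⟨ *-identityʳ (toℚ (m /ℕ n)) ⟨
      toℚ (m /ℕ n) * 1ℚ           ≡⟨ cong (_*_ (toℚ (m /ℕ n))) (trans (*-comm (toℚ n) x) x*n≡1) ⟨
      toℚ (m /ℕ n) * (toℚ n * x)  ≡⟨ *-assoc (toℚ (m /ℕ n)) (toℚ n) x ⟨
      toℚ (m /ℕ n) * toℚ n * x    ≡⟨ cong (_* x) (toℚ-* (m /ℕ n) n) ⟨
      toℚ (m /ℕ n ℕ.* n) * x      ∎) ⟩
  1ℚ + toℚ (m /ℕ n ℕ.* n) * x     ≤⟨ +-monoʳ-≤ 1ℚ (*-monoʳ-≤-nonNeg x {{nonNegative 0≤x}} (toℚ-mono-≤ (m/n*n≤m m n))) ⟩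
  1ℚ + toℚ m * x                  ∎
  where
  open ≤-Reasoning
  0≤x : 0ℚ ≤ x
  0≤x = <⇒≤ (*≡1⇒pos (toℚ-nonNeg n) x*n≡1)

-- Weight of a non-big, non-dense item

nonBig⇒thin : ∀ {ε₁ ε₂} i → NonMedium ε₂ ε₁ i → ¬ Big ε₁ i → w i ≤ ε₂ ⊎ h i ≤ ε₂
nonBig⇒thin {ε₁} {ε₂} i (w-nonMedium , h-nonMedium , _) nonBig with ε₁ <? w i
... | yes ε₁<w = inj₂ (≮⇒≥ λ ε₂<h → h-nonMedium (ε₂<h , ≮⇒≥ λ ε₁<h → nonBig (ε₁<w , ε₁<h)))
... | no ε₁≮w = inj₁ (≮⇒≥ λ ε₂<w → w-nonMedium (ε₂<w , ≮⇒≥ ε₁≮w))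

thin⇒area≤ : ∀ {ε₂} i → ValidItem i → w i ≤ ε₂ ⊎ h i ≤ ε₂ → w i * h i ≤ ε₂
thin⇒area≤ {ε₂} i ((0≤w , w≤1) , (0≤h , h≤1) , _) (inj₁ w≤ε₂) = begin
  w i * h i                ≤⟨ *-monoʳ-≤-nonNeg (h i) {{nonNegative 0≤h}} w≤ε₂ ⟩
  ε₂ * h i                 ≤⟨ *-monoˡ-≤-nonNeg ε₂ {{nonNegative (≤-trans 0≤w w≤ε₂)}} h≤1 ⟩
  ε₂ * 1ℚ                  ≡⟨ *-identityʳ ε₂ ⟩
  ε₂                       ∎
  where open ≤-Reasoning
thin⇒area≤ {ε₂} i ((0≤w , w≤1) , (0≤h , h≤1) , _) (inj₂ h≤ε₂) = begin
  w i * h i                ≤⟨ *-monoˡ-≤-nonNeg (w i) {{nonNegative 0≤w}} h≤ε₂ ⟩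
  w i * ε₂                 ≤⟨ *-monoʳ-≤-nonNeg ε₂ {{nonNegative (≤-trans 0≤h h≤ε₂)}} w≤1 ⟩
  1ℚ * ε₂                  ≡⟨ *-identityˡ ε₂ ⟩
  ε₂                       ∎
  where open ≤-Reasoning

nonDense⇒weight≤ : ∀ {ε₁} i → ValidItem i → ¬ Dense ε₁ i → v i ≤ (1ℚ ÷₀ (ε₁ * ε₁)) * (w i * h i)
nonDense⇒weight≤ {ε₁} i ((0≤w , _) , (0≤h , _) , _) nonDense = begin
  v i                                  ≡⟨ ÷₀-*-cancel (v i) (nonDense ∘ inj₁) ⟨
  (v i ÷₀ (w i * h i)) * (w i * h i)   ≤⟨ *-monoʳ-≤-nonNeg (w i * h i) {{nonNegative (*-nonNeg 0≤w 0≤h)}}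
                                           (≮⇒≥ (nonDense ∘ inj₂)) ⟩
  (1ℚ ÷₀ (ε₁ * ε₁)) * (w i * h i)      ∎
  where open ≤-Reasoning

smallItem⇒weight≤ : ∀ {ε ε₁ ε₂} i → 0ℚ < ε₁ → ε₂ ≤ ε * ε₁ * ε₁ * ½ →
                    ValidItem i → NonMedium ε₂ ε₁ i → ¬ Big ε₁ i → ¬ Dense ε₁ i → v i ≤ ½ * ε
smallItem⇒weight≤ {ε} {ε₁} {ε₂} i 0<ε₁ ε₂≤ valid nonMedium nonBig nonDense = begin
  v i                      ≤⟨ nonDense⇒weight≤ {ε₁} i valid nonDense ⟩
  d * (w i * h i)          ≤⟨ *-monoˡ-≤-nonNeg d {{nonNegative 0≤d}}
                                (≤-trans (thin⇒area≤ i valid (nonBig⇒thin i nonMedium nonBig)) ε₂≤) ⟩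
  d * (ε * ε₁ * ε₁ * ½)    ≡⟨ solve 3 (λ x e a → x :* (e :* a :* a :* con ½) := (x :* (a :* a)) :* (con ½ :* e))
                                refl d ε ε₁ ⟩
  (d * (ε₁ * ε₁)) * (½ * ε) ≡⟨ cong (_* (½ * ε)) d*ε₁²≡1 ⟩
  1ℚ * (½ * ε)             ≡⟨ *-identityˡ (½ * ε) ⟩
  ½ * ε                    ∎
  where
  open ≤-Reasoning
  d = 1ℚ ÷₀ (ε₁ * ε₁)
  0<ε₁² : 0ℚ < ε₁ * ε₁
  0<ε₁² = subst (_< ε₁ * ε₁) (*-zeroˡ ε₁) (*-monoˡ-<-pos ε₁ {{positive 0<ε₁}} 0<ε₁)
  d*ε₁²≡1 : d * (ε₁ * ε₁) ≡ 1ℚ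
  d*ε₁²≡1 = ÷₀-*-cancel 1ℚ (≢-sym (<⇒≢ 0<ε₁²))
  0≤d : 0ℚ ≤ d
  0≤d = <⇒≤ (*≡1⇒pos (<⇒≤ 0<ε₁²) d*ε₁²≡1)

-- Loads and greedy splitting

load : List Placed → ℚ
load ps = weight (items ps)

load-++ : ∀ ps qs → load (ps ++ qs) ≡ load ps + load qs
load-++ [] qs = sym (+-identityˡ (load qs))
load-++ (p ∷ ps) qs = trans (cong (_+_ (v (itm p))) (load-++ ps qs)) (sym (+-assoc (v (itm p)) (load ps) (load qs)))

load-concat≤ : ∀ {C} Ps → All (λ P → load P ≤ C) Ps → load (concat Ps) ≤ toℚ (length Ps) * C
load-concat≤ {C} [] [] = ≤-reflexive (sym (*-zeroˡ C))
load-concat≤ {C} (P ∷ Ps) (P≤C ∷ Ps≤C) = begin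
  load (P ++ concat Ps)            ≡⟨ load-++ P (concat Ps) ⟩
  load P + load (concat Ps)        ≤⟨ +-mono-≤ P≤C (load-concat≤ Ps Ps≤C) ⟩
  C + toℚ (length Ps) * C          ≡⟨ toℚ-suc-* (length Ps) C ⟨
  toℚ (suc (length Ps)) * C        ∎
  where open ≤-Reasoning

greedySplit : ℚ → List Placed → List Placed × List Placed
greedySplit c [] = [] , []
greedySplit c (p ∷ ps) with v (itm p) ≤? c
... | yes _ = Product.map₁ (p ∷_) (greedySplit (c - v (itm p)) ps)
... | no _ = [] , p ∷ ps

greedySplit-++ : ∀ c ps → proj₁ (greedySplit c ps) ++ proj₂ (greedySplit c ps) ≡ ps
greedySplit-++ c [] = refl
greedySplit-++ c (p ∷ ps) with v (itm p) ≤? c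
... | yes _ = cong (p ∷_) (greedySplit-++ (c - v (itm p)) ps)
... | no _ = refl

load-greedySplit₁≤ : ∀ {c} ps → 0ℚ ≤ c → load (proj₁ (greedySplit c ps)) ≤ c
load-greedySplit₁≤ [] 0≤c = 0≤c
load-greedySplit₁≤ {c} (p ∷ ps) 0≤c with v (itm p) ≤? c
... | no _ = 0≤c
... | yes v≤c = begin
  v (itm p) + load (proj₁ (greedySplit (c - v (itm p)) ps))
      ≤⟨ +-monoʳ-≤ (v (itm p)) (load-greedySplit₁≤ ps (p≤q⇒0≤q-p v≤c)) ⟩
  v (itm p) + (c - v (itm p))
      ≡⟨ solve 2 (λ a b → a :+ (b :- a) := b) refl (v (itm p)) c ⟩
  c   ∎
  where open ≤-Reasoning

greedySplit-nearlyFull : ∀ {c δ} ps → All (λ p → v (itm p) ≤ δ) ps →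
                         proj₂ (greedySplit c ps) ≡ [] ⊎ c < load (proj₁ (greedySplit c ps)) + δ
greedySplit-nearlyFull [] [] = inj₁ refl
greedySplit-nearlyFull {c} {δ} (p ∷ ps) (v≤δ ∷ vs≤δ) with v (itm p) ≤? c
... | no v≰c = inj₂ (<-≤-trans (≰⇒> v≰c) (subst (v (itm p) ≤_) (sym (+-identityˡ δ)) v≤δ))
... | yes _ with greedySplit-nearlyFull {c - v (itm p)} ps vs≤δ
...   | inj₁ rest≡[] = inj₁ rest≡[]
...   | inj₂ c-v<load+δ = inj₂ (subst₂ _<_
          (solve 2 (λ a b → a :+ (b :- a) := b) refl (v (itm p)) c)
          (sym (+-assoc (v (itm p)) _ δ))
          (+-monoʳ-< (v (itm p)) c-v<load+δ))

load-greedySplit₂≤ : ∀ {T c δ} ps → load ps ≤ T → All (λ p → v (itm p) ≤ δ) ps → 0ℚ ≤ T + δ - c →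
                     load (proj₂ (greedySplit c ps)) ≤ T + δ - c
load-greedySplit₂≤ {T} {c} {δ} ps load≤T vs≤δ 0≤bound with greedySplit-nearlyFull {c} ps vs≤δ
... | inj₁ rest≡[] = subst (λ rest → load rest ≤ T + δ - c) (sym rest≡[]) 0≤bound
... | inj₂ c<a+δ = <⇒≤ (begin-strict
  b                        ≡⟨ solve 2 (λ b c → b := b :+ c :- c) refl b c ⟩
  b + c - c                <⟨ +-monoˡ-< (- c) b+c<T+δ ⟩
  T + δ - c                ∎)
  where
  open ≤-Reasoning
  a = load (proj₁ (greedySplit c ps))
  b = load (proj₂ (greedySplit c ps))
  a+b≡load : a + b ≡ load ps
  a+b≡load = trans (sym (load-++ (proj₁ (greedySplit c ps)) _)) (cong load (greedySplit-++ c ps))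
  b+c<T+δ : b + c < T + δ
  b+c<T+δ = begin-strict
    b + c                  <⟨ +-monoʳ-< b c<a+δ ⟩
    b + (a + δ)            ≡⟨ solve 3 (λ a b d → b :+ (a :+ d) := (a :+ b) :+ d) refl a b δ ⟩
    (a + b) + δ            ≤⟨ +-monoˡ-≤ δ (subst (_≤ T) (sym a+b≡load) load≤T) ⟩
    T + δ                  ∎

-- Stacking packings

AllPairs-++⁻ : ∀ {A : Set} {R : A → A → Set} xs {ys} → AllPairs R (xs ++ ys) → AllPairs R xs × AllPairs R ys
AllPairs-++⁻ [] pairs = [] , pairs
AllPairs-++⁻ (x ∷ xs) (x~ys ∷ pairs) = Product.map₁ (All.++⁻ˡ xs x~ys ∷_) (AllPairs-++⁻ xs pairs)

IsPacking-++⁻ : ∀ {W H} ps {qs} → IsPacking W H (ps ++ qs) → IsPacking W H ps × IsPacking W H qs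
IsPacking-++⁻ ps (inside , disjoint) =
  (All.++⁻ˡ ps inside , proj₁ (AllPairs-++⁻ ps disjoint)) ,
  (All.++⁻ʳ ps inside , proj₂ (AllPairs-++⁻ ps disjoint))

IsPacking-mono : ∀ {W H H′} ps → H ≤ H′ → IsPacking W H ps → IsPacking W H′ ps
IsPacking-mono ps H≤H′ (inside , disjoint) =
  All.map (Product.map₂ (Product.map₂ (λ top≤H → ≤-trans top≤H H≤H′))) inside , disjoint

raise : ℚ → Placed → Placed
raise o p = place (itm p) (x p) (y p + o)

raise-Overlap⁻ : ∀ o p q → Overlap (raise o p) (raise o q) → Overlap p q
raise-Overlap⁻ o p q (x₁ , x₂ , x₃ , x₄ , y₁ , y₂ , y₃ , y₄) =
  x₁ , x₂ , x₃ , x₄ , cancel (y p) (h (itm p)) y₁ , cancel (y q) (h (itm q)) y₂ ,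
  cancel (y q) (h (itm q)) y₃ , cancel (y p) (h (itm p)) y₄
  where
  cancel : ∀ {a} b d → a + o < (b + o) + d → a < b + d
  cancel {a} b d lt = subst₂ _<_
    (solve 2 (λ a o → a :+ o :- o := a) refl a o)
    (solve 3 (λ b d o → b :+ o :+ d :- o := b :+ d) refl b d o)
    (+-monoˡ-< (- o) lt)

raise-IsPacking : ∀ {W H o} ps → 0ℚ ≤ o → IsPacking W H ps → IsPacking W (o + H) (map (raise o) ps)
raise-IsPacking {W} {H} {o} ps 0≤o (inside , disjoint) =
  All.map⁺ (All.map (λ {p} → raise-inside {p}) inside) ,
  AllPairs.map⁺ (AllPairs.map (λ {p} {q} ¬overlap → ¬overlap ∘ raise-Overlap⁻ o p q) disjoint)
  where
  raise-inside : ∀ {p} → InRegion W H p → InRegion W (o + H) (raise o p)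
  raise-inside {p} (inside-x , 0≤y , top≤H) = inside-x , +-mono-≤ 0≤y 0≤o , (begin
    y p + o + h (itm p)    ≡⟨ solve 3 (λ a b c → a :+ b :+ c := b :+ (a :+ c)) refl (y p) o (h (itm p)) ⟩
    o + (y p + h (itm p))  ≤⟨ +-monoʳ-≤ o top≤H ⟩
    o + H                  ∎)
    where open ≤-Reasoning

below-above-¬Overlap : ∀ {H} p q → y p + h (itm p) ≤ H → H ≤ y q → ¬ Overlap p q
below-above-¬Overlap p q top≤H H≤y (_ , _ , _ , _ , _ , _ , _ , y<top) =
  <-irrefl refl (<-≤-trans y<top (≤-trans top≤H H≤y))

stack : ℚ → List (List Placed) → List Placed
stack H [] = []
stack H (P ∷ Ps) = P ++ map (raise H) (stack H Ps)

items-stack : ∀ H Ps → items (stack H Ps) ≡ items (concat Ps)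
items-stack H [] = refl
items-stack H (P ∷ Ps) = begin
  items (P ++ map (raise H) (stack H Ps))         ≡⟨ List.map-++ itm P _ ⟩
  items P ++ items (map (raise H) (stack H Ps))  ≡⟨ cong (items P ++_) (List.map-∘ (stack H Ps)) ⟨
  items P ++ items (stack H Ps)                  ≡⟨ cong (items P ++_) (items-stack H Ps) ⟩
  items P ++ items (concat Ps)                   ≡⟨ List.map-++ itm P _ ⟨
  items (P ++ concat Ps)                         ∎
  where open ≡-Reasoning

items-concat-map-stack : ∀ H Cs → items (concat (map (stack H) Cs)) ≡ items (concat (concat Cs))
items-concat-map-stack H [] = refl
items-concat-map-stack H (C ∷ Cs) = begin
  items (stack H C ++ concat (map (stack H) Cs))          ≡⟨ List.map-++ itm (stack H C) _ ⟩
  items (stack H C) ++ items (concat (map (stack H) Cs))  ≡⟨ cong₂ _++_ (items-stack H C) (items-concat-map-stack H Cs) ⟩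
  items (concat C) ++ items (concat (concat Cs))          ≡⟨ List.map-++ itm (concat C) _ ⟨
  items (concat C ++ concat (concat Cs))                  ≡⟨ cong items (List.concat-++ C (concat Cs)) ⟩
  items (concat (C ++ concat Cs))                         ∎
  where open ≡-Reasoning

stack-IsPacking : ∀ {W H} Ps → 0ℚ ≤ H → All (IsPacking W H) Ps → IsPacking W (toℚ (length Ps) * H) (stack H Ps)
stack-IsPacking [] 0≤H [] = [] , []
stack-IsPacking {W} {H} (P ∷ Ps) 0≤H (packedP ∷ packedPs) =
  subst (λ top → IsPacking W top (stack H (P ∷ Ps))) (sym (toℚ-suc-* (length Ps) H))
    (All.++⁺ (proj₁ bottom) (proj₁ upper) , AllPairs.++⁺ (proj₂ bottom) (proj₂ upper) apart)
  where
  rest = stack-IsPacking Ps 0≤H packedPs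
  bottom : IsPacking W (H + toℚ (length Ps) * H) P
  bottom = IsPacking-mono P (p≤p+q (*-nonNeg (toℚ-nonNeg (length Ps)) 0≤H)) packedP
  upper : IsPacking W (H + toℚ (length Ps) * H) (map (raise H) (stack H Ps))
  upper = raise-IsPacking (stack H Ps) 0≤H rest
  apart : All (λ p → All (λ q → ¬ Overlap p q) (map (raise H) (stack H Ps))) P
  apart = All.map (λ {p} (_ , _ , top≤H) → All.map⁺ (All.map (λ {q} (_ , 0≤y , _) →
            below-above-¬Overlap p (raise H q) top≤H (subst (_≤ y q + H) (+-identityˡ H) (+-monoˡ-≤ H 0≤y)))
            (proj₁ rest))) (proj₁ packedP)

module _ {A : Set} where

  -- Exactly n blocks of at most s elements each; surplus blocks are empty (and make harmless empty bins).
  chunks : ℕ → ℕ → List A → List (List A)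
  chunks s zero xs = []
  chunks s (suc n) xs = take s xs ∷ chunks s n (drop s xs)

  length-map-chunks : ∀ {B : Set} (f : List A → B) s n xs → length (map f (chunks s n xs)) ≡ n
  length-map-chunks f s zero xs = refl
  length-map-chunks f s (suc n) xs = cong suc (length-map-chunks f s n (drop s xs))

  concat-chunks : ∀ s n xs → length xs ℕ.≤ n ℕ.* s → concat (chunks s n xs) ≡ xs
  concat-chunks s zero [] _ = refl
  concat-chunks s (suc n) xs len≤ = begin
    take s xs ++ concat (chunks s n (drop s xs))  ≡⟨ cong (take s xs ++_) (concat-chunks s n (drop s xs) drop≤) ⟩
    take s xs ++ drop s xs                       ≡⟨ List.take++drop≡id s xs ⟩
    xs                                           ∎
    where
    open ≡-Reasoning
    drop≤ : length (drop s xs) ℕ.≤ n ℕ.* s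
    drop≤ = subst (ℕ._≤ n ℕ.* s) (sym (List.length-drop s xs)) (ℕ.m≤n+o⇒m∸n≤o (length xs) s len≤)

  chunks-All : ∀ {P : A → Set} s n {xs} → All P xs → All (λ c → length c ℕ.≤ s × All P c) (chunks s n xs)
  chunks-All s zero _ = []
  chunks-All s (suc n) {xs} Pxs =
    (subst (ℕ._≤ s) (sym (List.length-take s xs)) (ℕ.m⊓n≤m s (length xs)) , All.take⁺ s Pxs) ∷
    chunks-All s n (All.drop⁺ s Pxs)

concat-map-++-↭ : ∀ {A B : Set} (f g : B → List A) zs →
                  concat (map f zs) ++ concat (map g zs) ↭ concat (map (λ z → f z ++ g z) zs)
concat-map-++-↭ f g [] = ↭-refl
concat-map-++-↭ f g (z ∷ zs) = begin
  (f z ++ F) ++ g z ++ G      ≡⟨ List.++-assoc (f z) F (g z ++ G) ⟩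
  f z ++ F ++ g z ++ G        ↭⟨ ↭.++⁺ˡ (f z) (↭.shifts F (g z)) ⟩
  f z ++ g z ++ F ++ G        ↭⟨ ↭.++⁺ˡ (f z) (↭.++⁺ˡ (g z) (concat-map-++-↭ f g zs)) ⟩
  f z ++ g z ++ FG            ≡⟨ List.++-assoc (f z) (g z) FG ⟨
  (f z ++ g z) ++ FG          ∎
  where
  open PermutationReasoning
  F = concat (map f zs)
  G = concat (map g zs)
  FG = concat (map (λ z → f z ++ g z) zs)

Piece : ℚ → ℚ → List Placed → Set
Piece H C P = IsPacking 1ℚ H P × load P ≤ C

stack-slackedBin : ∀ {ε₁ μ H C s} Ps → 0ℚ ≤ H → 0ℚ ≤ C → 0ℚ ≤ μ →
                   toℚ s * H ≤ 1ℚ → toℚ s * C ≤ 1ℚ - μ → length Ps ℕ.≤ s → All (Piece H C) Ps →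
                   IsBin (stack H Ps) × Slacked ε₁ μ (items (stack H Ps))
stack-slackedBin {_} {μ} {H} {C} {s} Ps 0≤H 0≤C 0≤μ sH≤1 sC≤1-μ len≤s pieces =
  (IsPacking-mono (stack H Ps) height≤1 (stack-IsPacking Ps 0≤H (All.map proj₁ pieces)) ,
   ≤-trans load≤1-μ (p-q≤p 1ℚ 0≤μ)) ,
  inj₁ load≤1-μ
  where
  open ≤-Reasoning
  height≤1 : toℚ (length Ps) * H ≤ 1ℚ
  height≤1 = ≤-trans (*-monoʳ-≤-nonNeg H {{nonNegative 0≤H}} (toℚ-mono-≤ len≤s)) sH≤1
  load≤1-μ : load (stack H Ps) ≤ 1ℚ - μ
  load≤1-μ = begin
    load (stack H Ps)              ≡⟨ cong weight (items-stack H Ps) ⟩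
    load (concat Ps)               ≤⟨ load-concat≤ Ps (All.map proj₂ pieces) ⟩
    toℚ (length Ps) * C            ≤⟨ *-monoʳ-≤-nonNeg C {{nonNegative 0≤C}} (toℚ-mono-≤ len≤s) ⟩
    toℚ s * C                      ≤⟨ sC≤1-μ ⟩
    1ℚ - μ                         ∎

SlackedPacking : ℚ → ℚ → List Item → List (List Placed) → Set
SlackedPacking ε₁ μ J bins =
  (items (concat bins) ↭ J) × All IsBin bins × All (λ B → Slacked ε₁ μ (items B)) bins

SlackedPacking-++ : ∀ {ε₁ μ J J′} bins {bins′} → SlackedPacking ε₁ μ J bins → SlackedPacking ε₁ μ J′ bins′ →
                    SlackedPacking ε₁ μ (J ++ J′) (bins ++ bins′)
SlackedPacking-++ bins {bins′} (J↭ , feasible , slacked) (J′↭ , feasible′ , slacked′) =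
  ↭-trans (↭-reflexive items-concat-++) (↭.++⁺ J↭ J′↭) ,
  All.++⁺ feasible feasible′ ,
  All.++⁺ slacked slacked′
  where
  items-concat-++ : items (concat (bins ++ bins′)) ≡ items (concat bins) ++ items (concat bins′)
  items-concat-++ = trans (cong items (sym (List.concat-++ bins bins′))) (List.map-++ itm (concat bins) _)

chunks-slackedPacking : ∀ {ε₁ μ H C} s n Ps → 0ℚ ≤ H → 0ℚ ≤ C → 0ℚ ≤ μ →
                        toℚ s * H ≤ 1ℚ → toℚ s * C ≤ 1ℚ - μ → length Ps ℕ.≤ n ℕ.* s → All (Piece H C) Ps →
                        SlackedPacking ε₁ μ (items (concat Ps)) (map (stack H) (chunks s n Ps))
chunks-slackedPacking {ε₁} {μ} {H} s n Ps 0≤H 0≤C 0≤μ sH≤1 sC≤1-μ len≤ pieces =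
  ↭-reflexive (trans (items-concat-map-stack H (chunks s n Ps)) (cong (items ∘ concat) (concat-chunks s n Ps len≤))) ,
  All.unzip (All.map⁺ (All.map (λ {Cs} (len≤s , Cs-pieces) →
    stack-slackedBin {ε₁} {μ} Cs 0≤H 0≤C 0≤μ sH≤1 sC≤1-μ len≤s Cs-pieces) (chunks-All s n pieces)))

-- Thin boxes

ThinBox : ℚ → List Placed → Set
ThinBox ε P = IsPacking 1ℚ ε P × All (λ p → v (itm p) ≤ ½ * ε) P × load P ≤ ½

smallBox⇒ThinBox : ∀ {ε ε₁ ε₂ H} P → 0ℚ < ε₁ → ε₂ ≤ ε * ε₁ * ε₁ * ½ → H ≤ ε → IsPacking 1ℚ H P →
                   All (λ p → ValidItem (itm p) × NonMedium ε₂ ε₁ (itm p) × ¬ Big ε₁ (itm p) × ¬ Dense ε₁ (itm p)) P →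
                   load P ≤ ½ → ThinBox ε P
smallBox⇒ThinBox {ε} P 0<ε₁ ε₂≤ H≤ε packed small light =
  IsPacking-mono P H≤ε packed ,
  All.map (λ {p} (valid , nonMedium , nonBig , nonDense) →
    smallItem⇒weight≤ {ε} (itm p) 0<ε₁ ε₂≤ valid nonMedium nonBig nonDense) small ,
  light

module ThinBoxes {ε : ℚ} (g : ℕ) (ε[2+g]≡1 : ε * toℚ (suc (suc g)) ≡ 1ℚ) (ε≤⅛ : ε ≤ + 1 / 8) where

  0≤ε : 0ℚ ≤ ε
  0≤ε = <⇒≤ (*≡1⇒pos (toℚ-nonNeg (suc (suc g))) ε[2+g]≡1)

  [1+g]ε≡1-ε : toℚ (suc g) * ε ≡ 1ℚ - ε
  [1+g]ε≡1-ε = begin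
    toℚ (suc g) * ε              ≡⟨ solve 2 (λ e t → t :* e := e :* (con 1ℚ :+ t) :- e) refl ε (toℚ (suc g)) ⟩
    ε * (1ℚ + toℚ (suc g)) - ε   ≡⟨ cong (λ t → ε * t - ε) (toℚ-suc (suc g)) ⟨
    ε * toℚ (suc (suc g)) - ε    ≡⟨ cong (_- ε) ε[2+g]≡1 ⟩
    1ℚ - ε                       ∎
    where open ≡-Reasoning

  [ε÷₀[1-ε]][1+g]≡1 : (ε ÷₀ (1ℚ - ε)) * toℚ (suc g) ≡ 1ℚ
  -- Multiplying by ε(2+g) = 1 avoids cancelling ε.
  [ε÷₀[1-ε]][1+g]≡1 = begin
    q * t                  ≡⟨ *-identityʳ (q * t) ⟨
    q * t * 1ℚ             ≡⟨ cong (_*_ (q * t)) ε[2+g]≡1 ⟨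
    q * t * (ε * k)        ≡⟨ solve 4 (λ q t e k → q :* t :* (e :* k) := q :* (t :* e) :* k) refl q t ε k ⟩
    q * (t * ε) * k        ≡⟨ cong (λ z → q * z * k) [1+g]ε≡1-ε ⟩
    q * (1ℚ - ε) * k       ≡⟨ cong (_* k) (÷₀-*-cancel ε (≢-sym (<⇒≢ 0<1-ε))) ⟩
    ε * k                  ≡⟨ ε[2+g]≡1 ⟩
    1ℚ                     ∎
    where
    open ≡-Reasoning
    q = ε ÷₀ (1ℚ - ε)
    t = toℚ (suc g)
    k = toℚ (suc (suc g))
    0<1-ε : 0ℚ < 1ℚ - ε
    0<1-ε = subst (_< 1ℚ - ε) (+-inverseʳ ε) (+-monoˡ-< (- ε) (≤-<-trans ε≤⅛ ⅛<1))

  c : ℚ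
  c = ½ * (1ℚ - ε)

  0≤c : 0ℚ ≤ c
  0≤c = *-nonNeg {½} (≤ᵇ⇒≤ _) (p≤q⇒0≤q-p (≤-trans ε≤⅛ (<⇒≤ ⅛<1)))

  main rest : List Placed → List Placed
  main P = proj₁ (greedySplit c P)
  rest P = proj₂ (greedySplit c P)

  main-rest-IsPacking : ∀ {P} → IsPacking 1ℚ ε P → IsPacking 1ℚ ε (main P) × IsPacking 1ℚ ε (rest P)
  main-rest-IsPacking {P} packed = IsPacking-++⁻ (main P) (subst (IsPacking 1ℚ ε) (sym (greedySplit-++ c P)) packed)

  main-Piece : ∀ {P} → ThinBox ε P → Piece ε c (main P)
  main-Piece {P} (packed , _ , _) =
    proj₁ (main-rest-IsPacking packed) ,
    load-greedySplit₁≤ P 0≤c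

  rest-Piece : ∀ {P} → ThinBox ε P → Piece ε ε (rest P)
  rest-Piece {P} (packed , light-items , light) =
    proj₂ (main-rest-IsPacking packed) ,
    subst (load (rest P) ≤_) budget≡ε (load-greedySplit₂≤ P light light-items (subst (0ℚ ≤_) (sym budget≡ε) 0≤ε))
    where
    budget≡ε : ½ + ½ * ε - c ≡ ε
    budget≡ε = solve 1 (λ e → con ½ :+ con ½ :* e :- con ½ :* (con 1ℚ :- e) := e) refl ε

  main-rest-↭ : ∀ boxes → items (concat (map main boxes)) ++ items (concat (map rest boxes)) ↭ items (concat boxes)
  main-rest-↭ boxes = begin
    items (concat (map main boxes)) ++ items (concat (map rest boxes))
      ≡⟨ List.map-++ itm (concat (map main boxes)) _ ⟨
    items (concat (map main boxes) ++ concat (map rest boxes))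
      ↭⟨ ↭.map⁺ itm (concat-map-++-↭ main rest boxes) ⟩
    items (concat (map (λ P → main P ++ rest P) boxes))
      ≡⟨ cong (items ∘ concat) (trans (List.map-cong (greedySplit-++ c) boxes) (List.map-id boxes)) ⟩
    items (concat boxes)
      ∎
    where open PermutationReasoning

  binCount : ∀ m → toℚ (suc (m /ℕ 2) ℕ.+ suc (m /ℕ suc g)) ≤ toℚ 2 + toℚ m * (½ + ε ÷₀ (1ℚ - ε))
  binCount m = begin
    toℚ (suc (m /ℕ 2) ℕ.+ suc (m /ℕ suc g))
      ≡⟨ toℚ-+ (suc (m /ℕ 2)) _ ⟩
    toℚ (suc (m /ℕ 2)) + toℚ (suc (m /ℕ suc g))
      ≤⟨ +-mono-≤ (toℚ[1+m/n]≤1+m*x m 2 refl) (toℚ[1+m/n]≤1+m*x m (suc g) [ε÷₀[1-ε]][1+g]≡1) ⟩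
    (1ℚ + toℚ m * ½) + (1ℚ + toℚ m * q)
      ≡⟨ solve 2 (λ m q → (con 1ℚ :+ m :* con ½) :+ (con 1ℚ :+ m :* q) := con (toℚ 2) :+ m :* (con ½ :+ q))
           refl (toℚ m) q ⟩
    toℚ 2 + toℚ m * (½ + q)
      ∎
    where
    open ≤-Reasoning
    q = ε ÷₀ (1ℚ - ε)

  packThinBoxes : ∀ {ε₁} boxes → All (ThinBox ε) boxes →
                  Σ (List (List Placed)) λ bins →
                    SlackedPacking ε₁ ε (items (concat boxes)) bins
                    × toℚ (length bins) ≤ toℚ 2 + toℚ (length boxes) * (½ + ε ÷₀ (1ℚ - ε))
  packThinBoxes {ε₁} boxes thin =
    mainBins ++ restBins ,
    Product.map₁ (λ J↭ → ↭-trans J↭ (main-rest-↭ boxes)) (SlackedPacking-++ {ε₁} {ε} mainBins mainPacking restPacking) ,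
    subst (λ n → toℚ n ≤ toℚ 2 + toℚ m * (½ + ε ÷₀ (1ℚ - ε))) (sym length-bins) (binCount m)
    where
    m = length boxes
    mainBins = map (stack ε) (chunks 2 (suc (m /ℕ 2)) (map main boxes))
    restBins = map (stack ε) (chunks (suc g) (suc (m /ℕ suc g)) (map rest boxes))

    fits : ∀ n .{{_ : ℕ.NonZero n}} (f : List Placed → List Placed) → length (map f boxes) ℕ.≤ suc (m /ℕ n) ℕ.* n
    fits n f = subst (ℕ._≤ suc (m /ℕ n) ℕ.* n) (sym (List.length-map f boxes)) (m≤[1+m/n]*n m n)

    mainPacking : SlackedPacking ε₁ ε (items (concat (map main boxes))) mainBins
    mainPacking = chunks-slackedPacking {ε₁} {ε} 2 _ (map main boxes) 0≤ε 0≤c 0≤ε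
      (≤-trans (*-monoˡ-≤-nonNeg (toℚ 2) {{nonNegative (toℚ-nonNeg 2)}} ε≤⅛) (≤ᵇ⇒≤ _))
      (≤-reflexive (solve 1 (λ e → con (toℚ 2) :* (con ½ :* (con 1ℚ :- e)) := con 1ℚ :- e) refl ε))
      (fits 2 main) (All.map⁺ (All.map main-Piece thin))

    restPacking : SlackedPacking ε₁ ε (items (concat (map rest boxes))) restBins
    restPacking = chunks-slackedPacking {ε₁} {ε} (suc g) _ (map rest boxes) 0≤ε 0≤ε 0≤ε
      (≤-trans (≤-reflexive [1+g]ε≡1-ε) (p-q≤p 1ℚ 0≤ε)) (≤-reflexive [1+g]ε≡1-ε)
      (fits (suc g) rest) (All.map⁺ (All.map rest-Piece thin))

    length-bins : length (mainBins ++ restBins) ≡ suc (m /ℕ 2) ℕ.+ suc (m /ℕ suc g)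
    length-bins = trans (List.length-++ mainBins)
      (cong₂ ℕ._+_ (length-map-chunks (stack ε) 2 (suc (m /ℕ 2)) (map main boxes))
                   (length-map-chunks (stack ε) (suc g) (suc (m /ℕ suc g)) (map rest boxes)))

εK≡1⇒K≡2+g : ∀ {ε} K → ε * toℚ K ≡ 1ℚ → ε ≤ + 1 / 8 → ∃ λ g → ε * toℚ (suc (suc g)) ≡ 1ℚ
εK≡1⇒K≡2+g {ε} zero ε0≡1 _ = contradiction (trans (sym (*-zeroʳ ε)) ε0≡1) λ ()
εK≡1⇒K≡2+g {ε} (suc zero) ε1≡1 ε≤⅛ =
  contradiction (subst (_≤ + 1 / 8) (trans (sym (*-identityʳ ε)) ε1≡1) ε≤⅛) λ 1≤⅛ → <-irrefl refl (<-≤-trans ⅛<1 1≤⅛)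
εK≡1⇒K≡2+g (suc (suc g)) ε[2+g]≡1 _ = g , ε[2+g]≡1

lemma40 : (ε ε₁ ε₂ : ℚ) →
          Σ ℕ (λ k → ε * toℚ (2 Data.Nat.* k) ≡ 1ℚ) → ε ≤ + 1 / 8 →
          Σ ℕ (λ a → ε₁ * toℚ a ≡ 1ℚ) → ε₁ ≤ + 1 / 5 → ε₁ ≤ (+ 2 / 3) * ε →
          Σ ℕ (λ b → ε₂ * toℚ b ≡ 1ℚ) → ε₂ ≤ ε * ε₁ * ε₁ * ½ →
          (m : ℕ) (hb : Fin m → ℚ) (box : Fin m → List Placed) →
          (∀ j → 0ℚ ≤ hb j × hb j ≤ ε) →
          (∀ j → IsPacking 1ℚ (hb j) (box j)) →
          (∀ j → All (λ p → ValidItem (itm p) × NonMedium ε₂ ε₁ (itm p)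
                            × ¬ Big ε₁ (itm p) × ¬ Dense ε₁ (itm p)) (box j)) →
          (∀ j → weight (items (box j)) ≤ ½) →
          Σ (List (List Placed)) (λ bins →
            (items (concat bins) ↭ items (concat (tabulate box)))
            × All IsBin bins
            × All (λ B → Slacked ε₁ ε (items B)) bins
            × toℚ (length bins) ≤ toℚ 2 + toℚ m * (½ + ε ÷₀ (1ℚ - ε)))
lemma40 ε ε₁ ε₂ (k , ε[2k]≡1) ε≤⅛ (a , ε₁a≡1) _ _ _ ε₂≤ m hb box hb≤ε packed small light =
  let g , ε[2+g]≡1 = εK≡1⇒K≡2+g (2 ℕ.* k) ε[2k]≡1 ε≤⅛
      0<ε₁ = *≡1⇒pos (toℚ-nonNeg a) ε₁a≡1
      thin = All.tabulate⁺ λ j → smallBox⇒ThinBox (box j) 0<ε₁ ε₂≤ (proj₂ (hb≤ε j)) (packed j) (small j) (light j)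
      bins , (permuted , feasible , slacked) , count = ThinBoxes.packThinBoxes g ε[2+g]≡1 ε≤⅛ {ε₁} (tabulate box) thin
  in bins , permuted , feasible , slacked ,
     subst (λ n → toℚ (length bins) ≤ toℚ 2 + toℚ n * (½ + ε ÷₀ (1ℚ - ε))) (List.length-tabulate box) count
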